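{- Let $\langle F,G,\mathbb F,\mathbb G,H_{grd},F_{exp},G_{exp},\theta\rangle$ be an interpolant lifting base, and let $\mathbb{FG}=\mathbb F\cup\mathbb G$. Let $\{t_1,\dots,t_n\}$ be the set of $\mathbb{FG}$-terms that have an $\mathbb{FG}$-terms-maximal occurrence in $H_{grd}$, ordered such that if $t_i$ is a strict subterm of $t_j$ then $i<j$. Let $v_1,\dots,v_n$ be fresh pairwise distinct variables and let $\sigma$ be the injective substitution $\{v_i\mapsto t_i\mid i\in\{1,\dots,n\}\}$. For $i\in\{1,\dots,n\}$ let $Q_i=\exists$ if $t_i$ is an $\mathbb F$-term and $Q_i=\forall$ otherwise (that is, if $t_i$ is a $\mathbb G$-term). Then $$Q_1v_1\ldots Q_nv_n\,H_{grd}\sigma^{ -1}$$ is a Craig-Lyndon interpolant of $F$ and $G$.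
   Context: Formulas are first-order without equality, built from atoms, $\top,\bot,\lnot,\land,\lor,\forall,\exists$; polarity of a subformula occurrence is positive (negative) if it is under an even (odd) number of negations. $\mathrm{pred}(F)$ is the set of pairs $\langle p,pol\rangle$ ($p$ a predicate, $pol\in\{+,-\}$) such that an atom with predicate $p$ occurs in $F$ with polarity $pol$. $\mathrm{fun}(E)$ is the set of function symbols (including constants) occurring in $E$ (for a set of terms, the union); $\mathrm{var}(E)$ the set of variables; $\mathrm{free}(F)$ the free variables; $\mathrm{voc}(F)=\mathrm{pred}(F)\cup\mathrm{fun}(F)$. A Craig-Lyndon interpolant of $F,G$ is a formula $H$ with $F\models H\models G$, $\mathrm{voc}(H)\subseteq\mathrm{voc}(F)\cap\mathrm{voc}(G)$, $\mathrm{free}(H)\subseteq\mathrm{free}(F)\cap\mathrm{free}(G)$. $\exists\mathbb F$, $\forall\mathbb G$ denote second-order quantification over the function symbols in these sets. For a set $\mathbb S$ of function symbols, an $\mathbb S$-term is a term whose outermost function symbol is in $\mathbb S$. For a set $\mathcal T$ of terms, an occurrence of a member of $\mathcal T$ in $E$ is $\mathcal T$-maximal if it is not within an occurrence of another member of $\mathcal T$. For an injective substitution $\sigma$, $E\sigma^{ -1}$ denotes $E$ with every $\mathrm{rng}(\sigma)$-maximal occurrence of a term $t\in\mathrm{rng}(\sigma)$ replaced by the variable mapped by $\sigma$ to $t$. An interpolant lifting base is a tuple $\langle F,G,\mathbb F,\mathbb G,H_{grd},F_{exp},G_{exp},\theta\rangle$ where $F,G$ are first-order sentences, $\mathbb F,\mathbb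 G$ are disjoint sets of function symbols, $H_{grd}$ is a ground formula, $F_{exp},G_{exp}$ are quantifier-free formulas and $\theta$ is a ground substitution such that: (1) $F\models\exists\mathbb F\,\forall U\,F_{exp}$ with $U=\mathrm{var}(F_{exp})$; (1') $\forall\mathbb G\,\exists V\,G_{exp}\models G$ with $V=\mathrm{var}(G_{exp})$; (2) $\mathrm{pred}(F_{exp})\subseteq\mathrm{pred}(F)$; (2') $\mathrm{pred}(G_{exp})\subseteq\mathrm{pred}(G)$; (3) $\mathrm{fun}(F_{exp})\subseteq(\mathrm{fun}(F)\cap\mathrm{fun}(G))\cup\mathbb F$; (3') $\mathrm{fun}(G_{exp})\subseteq(\mathrm{fun}(F)\cap\mathrm{fun}(G))\cup\mathbb G$; (4) $\mathrm{fun}(F)\cap\mathbb G=\emptyset$; (4') $\mathrm{fun}(G)\cap\mathbb F=\emptyset$; (5) $\mathrm{dom}(\theta)=\mathrm{var}(F_{exp})\cup\mathrm{var}(G_{exp})$; (6) $\mathrm{fun}(\mathrm{rng}(\theta))\subseteq\mathrm{fun}(F_{exp})\cup\mathrm{fun}(G_{exp})\cup\{c_0\}$, where $c_0$ is a constant in $\mathbb F\cup\mathbb G$; (7) $H_{grd}$ is a Craig-Lyndon interpolant of $F_{exp}\theta$ and $G_{exp}\theta$. -}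

module Defs where

open import Level using (0ℓ)
open import Data.Nat using (ℕ; zero; suc; _≟_)
open import Data.Fin using (Fin; zero; suc)
open import Data.Product using (Σ; _×_; _,_; proj₁; proj₂; ∃)
open import Data.Sum using (_⊎_)
open import Data.Empty using (⊥)
open import Data.Unit using (⊤)
open import Data.Vec using (Vec; []; _∷_)
open import Data.Vec.Relation.Unary.Any using (Any)
open import Data.Vec.Relation.Unary.All using (All)
open import Data.Vec.Relation.Binary.Pointwise.Inductive using (Pointwise)
open import Relation.Nullary using (¬_; yes; no)
open import Relation.Binary.PropositionalEquality using (_≡_; _≢_)

Var : Set
Var = ℕ

-- A function (resp. predicate) symbol is a pair (name , arity).
-- Constants are function symbols of arity 0.
FunSym : Set
FunSym = ℕ × ℕ

PredSym : Set
PredSym = ℕ × ℕ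

arity : ℕ × ℕ → ℕ
arity = proj₂

data Term : Set where
  var : Var → Term
  app : (f : FunSym) → Vec Term (arity f) → Term

data Formula : Set where
  atom : (p : PredSym) → Vec Term (arity p) → Formula
  ⊤ᶠ ⊥ᶠ : Formula
  ¬ᶠ_ : Formula → Formula
  _∧ᶠ_ _∨ᶠ_ : Formula → Formula → Formula
  ∀ᶠ ∃ᶠ : Var → Formula → Formula

data Quant : Set where
  ∀ᵠ ∃ᵠ : Quant

quant : Quant → Var → Formula → Formula
quant ∀ᵠ = ∀ᶠ
quant ∃ᵠ = ∃ᶠ

prefix : (n : ℕ) → (Fin n → Quant) → (Fin n → Var) → Formula → Formula
prefix zero    qs vs H = H
prefix (suc n) qs vs H =
  quant (qs zero) (vs zero) (prefix n (λ i → qs (suc i)) (λ i → vs (suc i)) H)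

data FunInT (f : FunSym) : Term → Set where
  here  : ∀ {ts} → FunInT f (app f ts)
  there : ∀ {g ts} → Any (FunInT f) ts → FunInT f (app g ts)

FunInF : FunSym → Formula → Set
FunInF f (atom p ts) = Any (FunInT f) ts
FunInF f ⊤ᶠ = ⊥
FunInF f ⊥ᶠ = ⊥
FunInF f (¬ᶠ A) = FunInF f A
FunInF f (A ∧ᶠ B) = FunInF f A ⊎ FunInF f B
FunInF f (A ∨ᶠ B) = FunInF f A ⊎ FunInF f B
FunInF f (∀ᶠ x A) = FunInF f A
FunInF f (∃ᶠ x A) = FunInF f A

data VarInT (x : Var) : Term → Set where
  here  : VarInT x (var x)
  there : ∀ {g ts} → Any (VarInT x) ts → VarInT x (app g ts)

VarInF : Var → Formula → Set
VarInF x (atom p ts) = Any (VarInT x) ts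
VarInF x ⊤ᶠ = ⊥
VarInF x ⊥ᶠ = ⊥
VarInF x (¬ᶠ A) = VarInF x A
VarInF x (A ∧ᶠ B) = VarInF x A ⊎ VarInF x B
VarInF x (A ∨ᶠ B) = VarInF x A ⊎ VarInF x B
VarInF x (∀ᶠ y A) = x ≡ y ⊎ VarInF x A
VarInF x (∃ᶠ y A) = x ≡ y ⊎ VarInF x A

FreeIn : Var → Formula → Set
FreeIn x (atom p ts) = Any (VarInT x) ts
FreeIn x ⊤ᶠ = ⊥
FreeIn x ⊥ᶠ = ⊥
FreeIn x (¬ᶠ A) = FreeIn x A
FreeIn x (A ∧ᶠ B) = FreeIn x A ⊎ FreeIn x B
FreeIn x (A ∨ᶠ B) = FreeIn x A ⊎ FreeIn x B
FreeIn x (∀ᶠ y A) = x ≢ y × FreeIn x A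
FreeIn x (∃ᶠ y A) = x ≢ y × FreeIn x A

Sentence : Formula → Set
Sentence A = ∀ x → ¬ FreeIn x A

QuantifierFree : Formula → Set
QuantifierFree (atom p ts) = ⊤
QuantifierFree ⊤ᶠ = ⊤
QuantifierFree ⊥ᶠ = ⊤
QuantifierFree (¬ᶠ A) = QuantifierFree A
QuantifierFree (A ∧ᶠ B) = QuantifierFree A × QuantifierFree B
QuantifierFree (A ∨ᶠ B) = QuantifierFree A × QuantifierFree B
QuantifierFree (∀ᶠ x A) = ⊥
QuantifierFree (∃ᶠ x A) = ⊥

GroundT : Term → Set
GroundT t = ∀ x → ¬ VarInT x t

GroundF : Formula → Set
GroundF A = QuantifierFree A × (∀ x → ¬ VarInF x A)

data Pol : Set where
  pos neg : Pol

flipPol : Pol → Pol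
flipPol pos = neg
flipPol neg = pos

-- ⟨p , pol⟩ ∈ pred(F), computed relative to polarity `ctx` of the context
PredOccAt : Pol → Pol → PredSym → Formula → Set
PredOccAt ctx pol p (atom q ts) = (q ≡ p) × (ctx ≡ pol)
PredOccAt ctx pol p ⊤ᶠ = ⊥
PredOccAt ctx pol p ⊥ᶠ = ⊥
PredOccAt ctx pol p (¬ᶠ A) = PredOccAt (flipPol ctx) pol p A
PredOccAt ctx pol p (A ∧ᶠ B) = PredOccAt ctx pol p A ⊎ PredOccAt ctx pol p B
PredOccAt ctx pol p (A ∨ᶠ B) = PredOccAt ctx pol p A ⊎ PredOccAt ctx pol p B
PredOccAt ctx pol p (∀ᶠ x A) = PredOccAt ctx pol p A
PredOccAt ctx pol p (∃ᶠ x A) = PredOccAt ctx pol p A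

PredOcc : Pol → PredSym → Formula → Set
PredOcc = PredOccAt pos

-- Substitution (θ : Var → Term; dom θ = { x | θ x ≢ var x })

Subst : Set
Subst = Var → Term

update : Subst → Var → Subst
update θ x y with y ≟ x
... | yes _ = var y
... | no  _ = θ y

mutual
  substT : Subst → Term → Term
  substT θ (var x) = θ x
  substT θ (app f ts) = app f (substTs θ ts)

  substTs : ∀ {n} → Subst → Vec Term n → Vec Term n
  substTs θ [] = []
  substTs θ (t ∷ ts) = substT θ t ∷ substTs θ ts

-- (only applied to quantifier-free formulas and ground substitutions here)
substF : Subst → Formula → Formula
substF θ (atom p ts) = atom p (substTs θ ts)
substF θ ⊤ᶠ = ⊤ᶠ
substF θ ⊥ᶠ = ⊥ᶠ
substF θ (¬ᶠ A) = ¬ᶠ substF θ A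
substF θ (A ∧ᶠ B) = substF θ A ∧ᶠ substF θ B
substF θ (A ∨ᶠ B) = substF θ A ∨ᶠ substF θ B
substF θ (∀ᶠ x A) = ∀ᶠ x (substF (update θ x) A)
substF θ (∃ᶠ x A) = ∃ᶠ x (substF (update θ x) A)

-- Semantics (Tarskian; truth values are types, used together with
-- the excluded-middle hypothesis in the theorem)

record Interp (D : Set) : Set₁ where
  field
    funI  : (f : FunSym) → Vec D (arity f) → D
    predI : (p : PredSym) → Vec D (arity p) → Set
open Interp public

Valuation : Set → Set
Valuation D = Var → D

updV : ∀ {D} → Valuation D → Var → D → Valuation D
updV ν x d y with y ≟ x
... | yes _ = d
... | no  _ = ν y

module _ {D : Set} (I : Interp D) where
  mutual
    evalT : Valuation D → Term → D
    evalT ν (var x) = ν x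
    evalT ν (app f ts) = funI I f (evalTs ν ts)

    evalTs : ∀ {n} → Valuation D → Vec Term n → Vec D n
    evalTs ν [] = []
    evalTs ν (t ∷ ts) = evalT ν t ∷ evalTs ν ts

  Sat : Valuation D → Formula → Set
  Sat ν (atom p ts) = predI I p (evalTs ν ts)
  Sat ν ⊤ᶠ = ⊤
  Sat ν ⊥ᶠ = ⊥
  Sat ν (¬ᶠ A) = ¬ Sat ν A
  Sat ν (A ∧ᶠ B) = Sat ν A × Sat ν B
  Sat ν (A ∨ᶠ B) = Sat ν A ⊎ Sat ν B
  Sat ν (∀ᶠ x A) = (d : D) → Sat (updV ν x d) A
  Sat ν (∃ᶠ x A) = Σ D λ d → Sat (updV ν x d) A

-- structures have non-empty domains
_⊨_ : Formula → Formula → Set₁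
A ⊨ B = (D : Set) → D → (I : Interp D) → (ν : Valuation D) → Sat I ν A → Sat I ν B

FunInterp : Set → Set
FunInterp D = (f : FunSym) → Vec D (arity f) → D

AgreeOutside : ∀ {D} → (FunSym → Set) → FunInterp D → FunInterp D → Set
AgreeOutside S φ' φ = ∀ f → ¬ S f → ∀ ds → φ' f ds ≡ φ f ds

withFun : ∀ {D} → Interp D → FunInterp D → Interp D
withFun I φ' = record { funI = φ' ; predI = predI I }

AgreeOutsideVars : ∀ {D} → Formula → Valuation D → Valuation D → Set
AgreeOutsideVars A ν' ν = ∀ x → ¬ VarInF x A → ν' x ≡ ν x

-- Sat I ν (∃𝔽 ∀U A)  with U = var(A)
Sat∃SO∀ : ∀ {D} → Interp D → Valuation D → (FunSym → Set) → Formula → Set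
Sat∃SO∀ {D} I ν 𝔽 A =
  Σ (FunInterp D) λ φ' → AgreeOutside 𝔽 φ' (funI I) ×
    ((ν' : Valuation D) → AgreeOutsideVars A ν' ν → Sat (withFun I φ') ν' A)

-- Sat I ν (∀𝔾 ∃V A)  with V = var(A)
Sat∀SO∃ : ∀ {D} → Interp D → Valuation D → (FunSym → Set) → Formula → Set
Sat∀SO∃ {D} I ν 𝔾 A =
  (φ' : FunInterp D) → AgreeOutside 𝔾 φ' (funI I) →
    Σ (Valuation D) λ ν' → AgreeOutsideVars A ν' ν × Sat (withFun I φ') ν' A

record CraigLyndon (A B H : Formula) : Set₁ where
  field
    A⊨H   : A ⊨ H
    H⊨B   : H ⊨ B
    pred⊆ : ∀ pol p → PredOcc pol p H → PredOcc pol p A × PredOcc pol p B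
    fun⊆  : ∀ f → FunInF f H → FunInF f A × FunInF f B
    free⊆ : ∀ x → FreeIn x H → FreeIn x A × FreeIn x B

record LiftingBase : Set₁ where
  field
    F G : Formula
    𝔽 𝔾 : FunSym → Set
    Hgrd Fexp Gexp : Formula
    θ : Subst
    c₀ : FunSym
    F-sentence : Sentence F
    G-sentence : Sentence G
    disjoint : ∀ f → 𝔽 f → 𝔾 f → ⊥
    Hgrd-ground : GroundF Hgrd
    Fexp-qf : QuantifierFree Fexp
    Gexp-qf : QuantifierFree Gexp
    θ-ground : ∀ x → θ x ≢ var x → GroundT (θ x)
    cond1  : (D : Set) → D → (I : Interp D) → (ν : Valuation D) →
             Sat I ν F → Sat∃SO∀ I ν 𝔽 Fexp
    cond1' : (D : Set) → D → (I : Interp D) → (ν : Valuation D) →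
             Sat∀SO∃ I ν 𝔾 Gexp → Sat I ν G
    cond2  : ∀ pol p → PredOcc pol p Fexp → PredOcc pol p F
    cond2' : ∀ pol p → PredOcc pol p Gexp → PredOcc pol p G
    cond3  : ∀ f → FunInF f Fexp → (FunInF f F × FunInF f G) ⊎ 𝔽 f
    cond3' : ∀ f → FunInF f Gexp → (FunInF f F × FunInF f G) ⊎ 𝔾 f
    cond4  : ∀ f → FunInF f F → ¬ 𝔾 f
    cond4' : ∀ f → FunInF f G → ¬ 𝔽 f
    cond5→ : ∀ x → θ x ≢ var x → VarInF x Fexp ⊎ VarInF x Gexp
    cond5← : ∀ x → VarInF x Fexp ⊎ VarInF x Gexp → θ x ≢ var x
    c₀-const : arity c₀ ≡ 0
    c₀-in    : 𝔽 c₀ ⊎ 𝔾 c₀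
    cond6 : ∀ x f → θ x ≢ var x → FunInT f (θ x) →
            FunInF f Fexp ⊎ FunInF f Gexp ⊎ f ≡ c₀
    cond7 : CraigLyndon (substF θ Fexp) (substF θ Gexp) Hgrd

IsSTerm : (FunSym → Set) → Term → Set
IsSTerm S (var x) = ⊥
IsSTerm S (app f ts) = S f

data _⊑_ (s : Term) : Term → Set where
  ⊑-refl : s ⊑ s
  ⊑-arg  : ∀ {f ts} → Any (s ⊑_) ts → s ⊑ app f ts

data _⊏_ (s : Term) : Term → Set where
  ⊏-arg : ∀ {f ts} → Any (s ⊑_) ts → s ⊏ app f ts

-- t has an occurrence in u that is not within an occurrence of
-- another member of the term set P
data MaxOccT (P : Term → Set) (t : Term) : Term → Set where
  mo-here : MaxOccT P t t
  mo-arg  : ∀ {f us} → ¬ P (app f us) → Any (MaxOccT P t) us → MaxOccT P t (app f us)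

MaxOccF : (Term → Set) → Term → Formula → Set
MaxOccF P t (atom p ts) = Any (MaxOccT P t) ts
MaxOccF P t ⊤ᶠ = ⊥
MaxOccF P t ⊥ᶠ = ⊥
MaxOccF P t (¬ᶠ A) = MaxOccF P t A
MaxOccF P t (A ∧ᶠ B) = MaxOccF P t A ⊎ MaxOccF P t B
MaxOccF P t (A ∨ᶠ B) = MaxOccF P t A ⊎ MaxOccF P t B
MaxOccF P t (∀ᶠ x A) = MaxOccF P t A
MaxOccF P t (∃ᶠ x A) = MaxOccF P t A

-- E σ⁻¹ for the injective substitution σ = { vs i ↦ ts i }:
-- InvT n ts vs u u' means u' = u σ⁻¹ (every rng(σ)-maximal occurrence of
-- ts i is replaced by vs i)
module _ (n : ℕ) (ts : Fin n → Term) (vs : Fin n → Var) where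
  data InvT : Term → Term → Set where
    inv-hit : ∀ i → InvT (ts i) (var (vs i))
    inv-var : ∀ x → (∀ i → ts i ≢ var x) → InvT (var x) (var x)
    inv-app : ∀ f {us us'} → (∀ i → ts i ≢ app f us) →
              Pointwise InvT us us' → InvT (app f us) (app f us')

  InvF : Formula → Formula → Set
  InvF (atom p us) (atom q us') = Σ (p ≡ q) λ { _≡_.refl → Pointwise InvT us us' }
  InvF ⊤ᶠ ⊤ᶠ = ⊤
  InvF ⊥ᶠ ⊥ᶠ = ⊤
  InvF (¬ᶠ A) (¬ᶠ A') = InvF A A'
  InvF (A ∧ᶠ B) (A' ∧ᶠ B') = InvF A A' × InvF B B'
  InvF (A ∨ᶠ B) (A' ∨ᶠ B') = InvF A A' × InvF B B'
  InvF (∀ᶠ x A) (∀ᶠ y A') = x ≡ y × InvF A A'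
  InvF (∃ᶠ x A) (∃ᶠ y A') = x ≡ y × InvF A A'
  InvF _ _ = ⊥

-- Take a model of F and, by (1), reinterpret the 𝔽-symbols so that Fexp holds under every
-- valuation. For values e₁ … eₙ let herbrand e be the term model whose atoms are decided by
-- evaluating their arguments in the model with every tᵢ frozen at eᵢ. If each 𝔽-term tᵢ is frozen
-- at its true value, herbrand e satisfies Fexp θ, hence Hgrd by (7); and as every 𝔽∪𝔾-symbol of
-- Hgrd lies inside some tᵢ, Hgrd holds in herbrand e exactly when H′ = Hgrd σ⁻¹ holds in the model
-- under vᵢ ↦ eᵢ. The true value of tᵢ depends only on the eⱼ of its proper subterms, which come
-- earlier in the prefix, so this choice is a strategy for the ∃-positions that wins the prefix.
-- Dually for G, with the 𝔾-terms at the ∀-positions. For the vocabulary, σ⁻¹ removes every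
-- 𝔽∪𝔾-symbol of Hgrd, and θ only adds symbols of Fexp, Gexp or c₀ ∈ 𝔽∪𝔾.

module Submission where

open import Defs
open import Level using (0ℓ)
open import Axiom.ExcludedMiddle using (ExcludedMiddle)
open import Function using (id; _∘_)
open import Data.Bool using (if_then_else_)
open import Data.Nat using (ℕ; zero; suc; _≟_; s≤s)
open import Data.Fin using (Fin; _<_; zero; suc)
open import Data.Fin.Properties using (0≢1+n; suc-injective)
open import Data.Product using (Σ; ∃; _×_; _,_; proj₁; proj₂; map₁; map₂)
open import Data.Sum as Sum using (_⊎_; inj₁; inj₂; [_,_]′)
open import Data.Empty using (⊥-elim)
open import Data.Vec using (Vec; []; _∷_)
open import Data.Vec.Functional using (head; tail)
import Data.Vec.Functional as Vector
open import Data.Vec.Relation.Unary.Any using (Any; here; there)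
open import Data.Vec.Relation.Binary.Pointwise.Inductive using (Pointwise; []; _∷_)
open import Relation.Nullary using (¬_; Dec; yes; no; does)
open import Relation.Nullary.Decidable using (dec-true; dec-false)
open import Relation.Binary.PropositionalEquality
  using (_≡_; _≢_; refl; sym; trans; cong; cong₂; subst; module ≡-Reasoning)

∀ᵠ≢∃ᵠ : ∀ᵠ ≢ ∃ᵠ
∀ᵠ≢∃ᵠ ()

updV-≡ : ∀ {D} (ν : Valuation D) x d → updV ν x d x ≡ d
updV-≡ ν x d with x ≟ x
... | yes _  = refl
... | no x≢x = ⊥-elim (x≢x refl)

updV-≢ : ∀ {D} (ν : Valuation D) {x} d {y} → y ≢ x → updV ν x d y ≡ ν y
updV-≢ ν {x} d {y} y≢x with y ≟ x
... | yes y≡x = ⊥-elim (y≢x y≡x)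
... | no _    = refl

updVs : ∀ {D} m → (Fin m → Var) → (Fin m → D) → Valuation D → Valuation D
updVs zero    vs e ν = ν
updVs (suc m) vs e ν = updVs m (tail vs) (tail e) (updV ν (head vs) (head e))

updVs-∉ : ∀ {D} m vs (e : Fin m → D) ν {y} → (∀ j → vs j ≢ y) → updVs m vs e ν y ≡ ν y
updVs-∉ zero    vs e ν y∉ = refl
updVs-∉ (suc m) vs e ν y∉ =
  trans (updVs-∉ m (tail vs) (tail e) _ (y∉ ∘ suc)) (updV-≢ ν (head e) (y∉ zero ∘ sym))

updVs-≡ : ∀ {D} m vs (e : Fin m → D) ν → (∀ i j → vs i ≡ vs j → i ≡ j) →
          ∀ i → updVs m vs e ν (vs i) ≡ e i
updVs-≡ (suc m) vs e ν vs-inj zero =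
  trans (updVs-∉ m (tail vs) (tail e) _ (λ j eq → 0≢1+n (vs-inj zero (suc j) (sym eq))))
        (updV-≡ ν (vs zero) (e zero))
updVs-≡ (suc m) vs e ν vs-inj (suc i) =
  updVs-≡ m (tail vs) (tail e) _ (λ a b eq → suc-injective (vs-inj (suc a) (suc b) eq)) i

module _ (em : ExcludedMiddle 0ℓ) {D : Set} where

  patch : Formula → (Var → D) → Valuation D → Valuation D
  patch A g ν x = if does (em {VarInF x A}) then g x else ν x

  patch-in : ∀ A {g ν x} → VarInF x A → patch A g ν x ≡ g x
  patch-in A {x = x} x∈A rewrite dec-true (em {VarInF x A}) x∈A = refl

  patch-outside : ∀ A {g ν} → AgreeOutsideVars A (patch A g ν) ν
  patch-outside A x x∉A rewrite dec-false (em {VarInF x A}) x∉A = refl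

PredOccAt-quant : ∀ Q {x A c pol p} → PredOccAt c pol p (quant Q x A) → PredOccAt c pol p A
PredOccAt-quant ∀ᵠ o = o
PredOccAt-quant ∃ᵠ o = o

FunInF-quant : ∀ Q {x A f} → FunInF f (quant Q x A) → FunInF f A
FunInF-quant ∀ᵠ o = o
FunInF-quant ∃ᵠ o = o

FreeIn-quant : ∀ Q {x y A} → FreeIn y (quant Q x A) → y ≢ x × FreeIn y A
FreeIn-quant ∀ᵠ o = o
FreeIn-quant ∃ᵠ o = o

PredOccAt-prefix : ∀ m qs vs {H c pol p} → PredOccAt c pol p (prefix m qs vs H) → PredOccAt c pol p H
PredOccAt-prefix zero    qs vs o = o
PredOccAt-prefix (suc m) qs vs o = PredOccAt-prefix m (tail qs) (tail vs) (PredOccAt-quant (qs zero) o)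

FunInF-prefix : ∀ m qs vs {H f} → FunInF f (prefix m qs vs H) → FunInF f H
FunInF-prefix zero    qs vs o = o
FunInF-prefix (suc m) qs vs o = FunInF-prefix m (tail qs) (tail vs) (FunInF-quant (qs zero) o)

FreeIn-prefix : ∀ m qs vs {H y} → FreeIn y (prefix m qs vs H) → FreeIn y H × (∀ i → y ≢ vs i)
FreeIn-prefix zero    qs vs o = o , λ ()
FreeIn-prefix (suc m) qs vs o with FreeIn-quant (qs zero) o
... | y≢v₀ , o′ with FreeIn-prefix m (tail qs) (tail vs) o′
...   | inH , y∉ = inH , λ { zero → y≢v₀ ; (suc i) → y∉ i }

Strategy : Set → ℕ → Set
Strategy D m = (Fin m → D) → Fin m → D

Causal : ∀ {D m} → Strategy D m → Set
Causal W = ∀ e e′ i → (∀ j → j < i → e j ≡ e′ j) → W e i ≡ W e′ i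

Follows : ∀ {D m} → (Fin m → Quant) → Quant → Strategy D m → (Fin m → D) → Set
Follows qs Q W e = ∀ i → qs i ≡ Q → e i ≡ W e i

module _ {D : Set} {m : ℕ} where

  shift : Strategy D (suc m) → D → Strategy D m
  shift W d e i = W (d Vector.∷ e) (suc i)

  Causal-shift : ∀ {W} → Causal W → ∀ d → Causal (shift W d)
  Causal-shift c d e e′ i agree =
    c (d Vector.∷ e) (d Vector.∷ e′) (suc i) λ { zero _ → refl ; (suc j) (s≤s j<i) → agree j j<i }

  Causal-zero : ∀ {W : Strategy D (suc m)} → Causal W → ∀ e e′ → W e zero ≡ W e′ zero
  Causal-zero c e e′ = c e e′ zero (λ _ ())

  Follows-∷ : ∀ {qs Q W d e} → (qs zero ≡ Q → d ≡ W (d Vector.∷ e) zero) →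
              Follows (tail qs) Q (shift W d) e → Follows qs Q W (d Vector.∷ e)
  Follows-∷ follows₀ follows zero    = follows₀
  Follows-∷ follows₀ follows (suc i) = follows i

module _ {D : Set} (I : Interp D) (d₀ : D) where

  Sat-prefix-intro : ∀ m qs vs {H} ν {W : Strategy D m} → Causal W →
    (∀ e → Follows qs ∃ᵠ W e → Sat I (updVs m vs e ν) H) → Sat I ν (prefix m qs vs H)
  Sat-prefix-intro zero qs vs ν c k = k (λ ()) (λ ())
  Sat-prefix-intro (suc m) qs vs ν {W} c k with qs zero in q₀
  ... | ∀ᵠ = λ d → Sat-prefix-intro m (tail qs) (tail vs) _ (Causal-shift {W = W} c d) λ e →
                 k (d Vector.∷ e) ∘ Follows-∷ {W = W} (λ q → ⊥-elim (∀ᵠ≢∃ᵠ (trans (sym q₀) q)))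
  -- A causal strategy ignores its argument at position zero, so it can be played without
  -- knowing the later moves.
  ... | ∃ᵠ = let d = W (λ _ → d₀) zero in
             d , Sat-prefix-intro m (tail qs) (tail vs) _ (Causal-shift {W = W} c d) λ e →
                   k (d Vector.∷ e) ∘ Follows-∷ {W = W} (λ _ → Causal-zero c (λ _ → d₀) (d Vector.∷ e))

  Sat-prefix-elim : ∀ m qs vs {H} ν {W : Strategy D m} → Causal W → Sat I ν (prefix m qs vs H) →
    ∃ λ e → Follows qs ∀ᵠ W e × Sat I (updVs m vs e ν) H
  Sat-prefix-elim zero qs vs ν c s = (λ ()) , (λ ()) , s
  Sat-prefix-elim (suc m) qs vs ν {W} c s with qs zero in q₀
  ... | ∀ᵠ = let d = W (λ _ → d₀) zero
                 e , follows , sat = Sat-prefix-elim m (tail qs) (tail vs) _ (Causal-shift {W = W} c d) (s d)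
             in d Vector.∷ e ,
                Follows-∷ {W = W} (λ _ → Causal-zero c (λ _ → d₀) (d Vector.∷ e)) follows , sat
  ... | ∃ᵠ = let d , s′ = s
                 e , follows , sat = Sat-prefix-elim m (tail qs) (tail vs) _ (Causal-shift {W = W} c d) s′
             in d Vector.∷ e , Follows-∷ {W = W} (λ q → ⊥-elim (∀ᵠ≢∃ᵠ (trans (sym q) q₀))) follows , sat

mutual
  FunInT-substT : ∀ θ {f} t → FunInT f (substT θ t) →
                  FunInT f t ⊎ ∃ λ y → VarInT y t × FunInT f (θ y)
  FunInT-substT θ (var x)    o         = inj₂ (x , here , o)
  FunInT-substT θ (app g us) here      = inj₁ here
  FunInT-substT θ (app g us) (there o) = Sum.map there (map₂ (map₁ there)) (FunInTs-substTs θ us o)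

  FunInTs-substTs : ∀ θ {f k} (us : Vec Term k) → Any (FunInT f) (substTs θ us) →
                    Any (FunInT f) us ⊎ ∃ λ y → Any (VarInT y) us × FunInT f (θ y)
  FunInTs-substTs θ (u ∷ us) (here o)  = Sum.map here (map₂ (map₁ here)) (FunInT-substT θ u o)
  FunInTs-substTs θ (u ∷ us) (there o) = Sum.map there (map₂ (map₁ there)) (FunInTs-substTs θ us o)

FunInF-substF : ∀ θ {f} A → QuantifierFree A → FunInF f (substF θ A) →
                FunInF f A ⊎ ∃ λ y → VarInF y A × FunInT f (θ y)
FunInF-substF θ (atom p us) qf o = FunInTs-substTs θ us o
FunInF-substF θ (¬ᶠ A) qf o = FunInF-substF θ A qf o
FunInF-substF θ (A ∧ᶠ B) (qfA , qfB) (inj₁ o) = Sum.map inj₁ (map₂ (map₁ inj₁)) (FunInF-substF θ A qfA o)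
FunInF-substF θ (A ∧ᶠ B) (qfA , qfB) (inj₂ o) = Sum.map inj₂ (map₂ (map₁ inj₂)) (FunInF-substF θ B qfB o)
FunInF-substF θ (A ∨ᶠ B) (qfA , qfB) (inj₁ o) = Sum.map inj₁ (map₂ (map₁ inj₁)) (FunInF-substF θ A qfA o)
FunInF-substF θ (A ∨ᶠ B) (qfA , qfB) (inj₂ o) = Sum.map inj₂ (map₂ (map₁ inj₂)) (FunInF-substF θ B qfB o)

PredOccAt-substF : ∀ θ {c pol p} A → QuantifierFree A → PredOccAt c pol p (substF θ A) → PredOccAt c pol p A
PredOccAt-substF θ (atom q us) qf o = o
PredOccAt-substF θ (¬ᶠ A) qf o = PredOccAt-substF θ A qf o
PredOccAt-substF θ (A ∧ᶠ B) (qfA , qfB) o = Sum.map (PredOccAt-substF θ A qfA) (PredOccAt-substF θ B qfB) o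
PredOccAt-substF θ (A ∨ᶠ B) (qfA , qfB) o = Sum.map (PredOccAt-substF θ A qfA) (PredOccAt-substF θ B qfB) o

Hit : ∀ {n} → (Fin n → Term) → Term → Set
Hit ts u = ∃ λ i → ts i ≡ u

module _ {n : ℕ} (ts : Fin n → Term) (S : FunSym → Set) where

  CoveredT : Term → Set
  CoveredT u = ∀ t → IsSTerm S t → MaxOccT (IsSTerm S) t u → Hit ts t

  CoveredTs : ∀ {k} → Vec Term k → Set
  CoveredTs us = ∀ t → IsSTerm S t → Any (MaxOccT (IsSTerm S) t) us → Hit ts t

  Covered : Formula → Set
  Covered A = ∀ t → IsSTerm S t → MaxOccF (IsSTerm S) t A → Hit ts t

  CoveredT-app : ∀ {f us} → CoveredT (app f us) → (∀ i → ts i ≢ app f us) → ¬ S f × CoveredTs us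
  CoveredT-app {f} {us} cov miss = ¬Sf , λ t St → cov t St ∘ mo-arg ¬Sf
    where
      ¬Sf : ¬ S f
      ¬Sf Sf = let i , tᵢ≡u = cov (app f us) Sf mo-here in miss i tᵢ≡u

module InverseSubstitution {n : ℕ} (ts : Fin n → Term) (vs : Fin n → Var) where

  InvTs : ∀ {k} → Vec Term k → Vec Term k → Set
  InvTs = Pointwise (InvT n ts vs)

  -- InvF as an inductive relation, so that it can be eliminated by structural recursion.
  data Inv : Formula → Formula → Set where
    atom      : ∀ p {us us′} → InvTs us us′ → Inv (atom p us) (atom p us′)
    ⊤ᶠ        : Inv ⊤ᶠ ⊤ᶠ
    ⊥ᶠ        : Inv ⊥ᶠ ⊥ᶠ
    ¬ᶠ_       : ∀ {A A′} → Inv A A′ → Inv (¬ᶠ A) (¬ᶠ A′)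
    _∧ᶠ_      : ∀ {A A′ B B′} → Inv A A′ → Inv B B′ → Inv (A ∧ᶠ B) (A′ ∧ᶠ B′)
    _∨ᶠ_      : ∀ {A A′ B B′} → Inv A A′ → Inv B B′ → Inv (A ∨ᶠ B) (A′ ∨ᶠ B′)
    ∀ᶠ        : ∀ x {A A′} → Inv A A′ → Inv (∀ᶠ x A) (∀ᶠ x A′)
    ∃ᶠ        : ∀ x {A A′} → Inv A A′ → Inv (∃ᶠ x A) (∃ᶠ x A′)

  InvF⇒Inv : ∀ A A′ → InvF n ts vs A A′ → Inv A A′
  InvF⇒Inv (atom p us) (atom q us′) (refl , r) = atom p r
  InvF⇒Inv ⊤ᶠ ⊤ᶠ _ = ⊤ᶠ
  InvF⇒Inv ⊥ᶠ ⊥ᶠ _ = ⊥ᶠ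
  InvF⇒Inv (¬ᶠ A) (¬ᶠ A′) r = ¬ᶠ InvF⇒Inv A A′ r
  InvF⇒Inv (A ∧ᶠ B) (A′ ∧ᶠ B′) (r , s) = InvF⇒Inv A A′ r ∧ᶠ InvF⇒Inv B B′ s
  InvF⇒Inv (A ∨ᶠ B) (A′ ∨ᶠ B′) (r , s) = InvF⇒Inv A A′ r ∨ᶠ InvF⇒Inv B B′ s
  InvF⇒Inv (∀ᶠ x A) (∀ᶠ y A′) (refl , r) = ∀ᶠ x (InvF⇒Inv A A′ r)
  InvF⇒Inv (∃ᶠ x A) (∃ᶠ y A′) (refl , r) = ∃ᶠ x (InvF⇒Inv A A′ r)
  InvF⇒Inv (atom _ _) ⊤ᶠ ()
  InvF⇒Inv (atom _ _) ⊥ᶠ ()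
  InvF⇒Inv (atom _ _) (¬ᶠ _) ()
  InvF⇒Inv (atom _ _) (_ ∧ᶠ _) ()
  InvF⇒Inv (atom _ _) (_ ∨ᶠ _) ()
  InvF⇒Inv (atom _ _) (∀ᶠ _ _) ()
  InvF⇒Inv (atom _ _) (∃ᶠ _ _) ()
  InvF⇒Inv ⊤ᶠ (atom _ _) ()
  InvF⇒Inv ⊤ᶠ ⊥ᶠ ()
  InvF⇒Inv ⊤ᶠ (¬ᶠ _) ()
  InvF⇒Inv ⊤ᶠ (_ ∧ᶠ _) ()
  InvF⇒Inv ⊤ᶠ (_ ∨ᶠ _) ()
  InvF⇒Inv ⊤ᶠ (∀ᶠ _ _) ()
  InvF⇒Inv ⊤ᶠ (∃ᶠ _ _) ()
  InvF⇒Inv ⊥ᶠ (atom _ _) ()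
  InvF⇒Inv ⊥ᶠ ⊤ᶠ ()
  InvF⇒Inv ⊥ᶠ (¬ᶠ _) ()
  InvF⇒Inv ⊥ᶠ (_ ∧ᶠ _) ()
  InvF⇒Inv ⊥ᶠ (_ ∨ᶠ _) ()
  InvF⇒Inv ⊥ᶠ (∀ᶠ _ _) ()
  InvF⇒Inv ⊥ᶠ (∃ᶠ _ _) ()
  InvF⇒Inv (¬ᶠ _) (atom _ _) ()
  InvF⇒Inv (¬ᶠ _) ⊤ᶠ ()
  InvF⇒Inv (¬ᶠ _) ⊥ᶠ ()
  InvF⇒Inv (¬ᶠ _) (_ ∧ᶠ _) ()
  InvF⇒Inv (¬ᶠ _) (_ ∨ᶠ _) ()
  InvF⇒Inv (¬ᶠ _) (∀ᶠ _ _) ()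
  InvF⇒Inv (¬ᶠ _) (∃ᶠ _ _) ()
  InvF⇒Inv (_ ∧ᶠ _) (atom _ _) ()
  InvF⇒Inv (_ ∧ᶠ _) ⊤ᶠ ()
  InvF⇒Inv (_ ∧ᶠ _) ⊥ᶠ ()
  InvF⇒Inv (_ ∧ᶠ _) (¬ᶠ _) ()
  InvF⇒Inv (_ ∧ᶠ _) (_ ∨ᶠ _) ()
  InvF⇒Inv (_ ∧ᶠ _) (∀ᶠ _ _) ()
  InvF⇒Inv (_ ∧ᶠ _) (∃ᶠ _ _) ()
  InvF⇒Inv (_ ∨ᶠ _) (atom _ _) ()
  InvF⇒Inv (_ ∨ᶠ _) ⊤ᶠ ()
  InvF⇒Inv (_ ∨ᶠ _) ⊥ᶠ ()
  InvF⇒Inv (_ ∨ᶠ _) (¬ᶠ _) ()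
  InvF⇒Inv (_ ∨ᶠ _) (_ ∧ᶠ _) ()
  InvF⇒Inv (_ ∨ᶠ _) (∀ᶠ _ _) ()
  InvF⇒Inv (_ ∨ᶠ _) (∃ᶠ _ _) ()
  InvF⇒Inv (∀ᶠ _ _) (atom _ _) ()
  InvF⇒Inv (∀ᶠ _ _) ⊤ᶠ ()
  InvF⇒Inv (∀ᶠ _ _) ⊥ᶠ ()
  InvF⇒Inv (∀ᶠ _ _) (¬ᶠ _) ()
  InvF⇒Inv (∀ᶠ _ _) (_ ∧ᶠ _) ()
  InvF⇒Inv (∀ᶠ _ _) (_ ∨ᶠ _) ()
  InvF⇒Inv (∀ᶠ _ _) (∃ᶠ _ _) ()
  InvF⇒Inv (∃ᶠ _ _) (atom _ _) ()
  InvF⇒Inv (∃ᶠ _ _) ⊤ᶠ ()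
  InvF⇒Inv (∃ᶠ _ _) ⊥ᶠ ()
  InvF⇒Inv (∃ᶠ _ _) (¬ᶠ _) ()
  InvF⇒Inv (∃ᶠ _ _) (_ ∧ᶠ _) ()
  InvF⇒Inv (∃ᶠ _ _) (_ ∨ᶠ _) ()
  InvF⇒Inv (∃ᶠ _ _) (∀ᶠ _ _) ()

  Inv-PredOccAt : ∀ {A A′ c pol p} → Inv A A′ → PredOccAt c pol p A′ → PredOccAt c pol p A
  Inv-PredOccAt (atom p r) o = o
  Inv-PredOccAt ⊤ᶠ ()
  Inv-PredOccAt ⊥ᶠ ()
  Inv-PredOccAt (¬ᶠ r)   o = Inv-PredOccAt r o
  Inv-PredOccAt (r ∧ᶠ s) o = Sum.map (Inv-PredOccAt r) (Inv-PredOccAt s) o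
  Inv-PredOccAt (r ∨ᶠ s) o = Sum.map (Inv-PredOccAt r) (Inv-PredOccAt s) o
  Inv-PredOccAt (∀ᶠ x r) o = Inv-PredOccAt r o
  Inv-PredOccAt (∃ᶠ x r) o = Inv-PredOccAt r o

  mutual
    InvT-VarInT : ∀ {u u′ x} → InvT n ts vs u u′ → GroundT u → VarInT x u′ → ∃ λ i → x ≡ vs i
    InvT-VarInT (inv-hit i)     ground here      = i , refl
    InvT-VarInT (inv-var y _)   ground here      = ⊥-elim (ground y here)
    InvT-VarInT (inv-app f _ r) ground (there o) = InvTs-VarInTs r (λ y → ground y ∘ there) o

    InvTs-VarInTs : ∀ {k} {us us′ : Vec Term k} {x} → InvTs us us′ → (∀ y → ¬ Any (VarInT y) us) →
                    Any (VarInT x) us′ → ∃ λ i → x ≡ vs i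
    InvTs-VarInTs (r ∷ rs) ground (here o)  = InvT-VarInT r (λ y → ground y ∘ here) o
    InvTs-VarInTs (r ∷ rs) ground (there o) = InvTs-VarInTs rs (λ y → ground y ∘ there) o

  Inv-FreeIn : ∀ {A A′ x} → Inv A A′ → (∀ y → ¬ VarInF y A) → FreeIn x A′ → ∃ λ i → x ≡ vs i
  Inv-FreeIn (atom p r) ground o        = InvTs-VarInTs r ground o
  Inv-FreeIn ⊤ᶠ         ground ()
  Inv-FreeIn ⊥ᶠ         ground ()
  Inv-FreeIn (¬ᶠ r)     ground o        = Inv-FreeIn r ground o
  Inv-FreeIn (r ∧ᶠ s)   ground (inj₁ o) = Inv-FreeIn r (λ y → ground y ∘ inj₁) o
  Inv-FreeIn (r ∧ᶠ s)   ground (inj₂ o) = Inv-FreeIn s (λ y → ground y ∘ inj₂) o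
  Inv-FreeIn (r ∨ᶠ s)   ground (inj₁ o) = Inv-FreeIn r (λ y → ground y ∘ inj₁) o
  Inv-FreeIn (r ∨ᶠ s)   ground (inj₂ o) = Inv-FreeIn s (λ y → ground y ∘ inj₂) o
  Inv-FreeIn (∀ᶠ y r)   ground o        = ⊥-elim (ground y (inj₁ refl))
  Inv-FreeIn (∃ᶠ y r)   ground o        = ⊥-elim (ground y (inj₁ refl))

  module _ (S : FunSym → Set) where

    mutual
      InvT-FunInT : ∀ {u u′ f} → InvT n ts vs u u′ → CoveredT ts S u → FunInT f u′ → FunInT f u × ¬ S f
      InvT-FunInT (inv-hit i)        cov ()
      InvT-FunInT (inv-var x _)      cov ()
      InvT-FunInT (inv-app g miss r) cov here      = here , proj₁ (CoveredT-app ts S cov miss)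
      InvT-FunInT (inv-app g miss r) cov (there o) =
        map₁ there (InvTs-FunInTs r (proj₂ (CoveredT-app ts S cov miss)) o)

      InvTs-FunInTs : ∀ {k} {us us′ : Vec Term k} {f} → InvTs us us′ → CoveredTs ts S us →
                      Any (FunInT f) us′ → Any (FunInT f) us × ¬ S f
      InvTs-FunInTs (r ∷ rs) cov (here o)  = map₁ here (InvT-FunInT r (λ t St → cov t St ∘ here) o)
      InvTs-FunInTs (r ∷ rs) cov (there o) = map₁ there (InvTs-FunInTs rs (λ t St → cov t St ∘ there) o)

    Inv-FunInF : ∀ {A A′ f} → Inv A A′ → Covered ts S A → FunInF f A′ → FunInF f A × ¬ S f
    Inv-FunInF (atom p r) cov o        = InvTs-FunInTs r cov o
    Inv-FunInF ⊤ᶠ         cov ()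
    Inv-FunInF ⊥ᶠ         cov ()
    Inv-FunInF (¬ᶠ r)     cov o        = Inv-FunInF r cov o
    Inv-FunInF (r ∧ᶠ s)   cov (inj₁ o) = map₁ inj₁ (Inv-FunInF r (λ t St → cov t St ∘ inj₁) o)
    Inv-FunInF (r ∧ᶠ s)   cov (inj₂ o) = map₁ inj₂ (Inv-FunInF s (λ t St → cov t St ∘ inj₂) o)
    Inv-FunInF (r ∨ᶠ s)   cov (inj₁ o) = map₁ inj₁ (Inv-FunInF r (λ t St → cov t St ∘ inj₁) o)
    Inv-FunInF (r ∨ᶠ s)   cov (inj₂ o) = map₁ inj₂ (Inv-FunInF s (λ t St → cov t St ∘ inj₂) o)
    Inv-FunInF (∀ᶠ x r)   cov o        = Inv-FunInF r cov o
    Inv-FunInF (∃ᶠ x r)   cov o        = Inv-FunInF r cov o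

module FrozenEvaluation (em : ExcludedMiddle 0ℓ) {n : ℕ} (ts : Fin n → Term)
                        (ts-injective : ∀ i j → ts i ≡ ts j → i ≡ j)
                        {D : Set} (I : Interp D) (d₀ : D) (ψ : FunInterp D) where

  -- val e u evaluates the ground term u with ψ, except that each tᵢ takes the value e i;
  -- variables get the junk value d₀.
  mutual
    val : (Fin n → D) → Term → D
    val e u = valBy e u em

    valBy : (Fin n → D) → (u : Term) → Dec (Hit ts u) → D
    valBy e u          (yes (i , _)) = e i
    valBy e (var _)    (no _)        = d₀
    valBy e (app f us) (no _)        = ψ f (vals e us)

    vals : ∀ {k} → (Fin n → D) → Vec Term k → Vec D k
    vals e []       = []
    vals e (u ∷ us) = val e u ∷ vals e us

  val-hit : ∀ e i → val e (ts i) ≡ e i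
  val-hit e i = valBy-hit em
    where
      valBy-hit : (h : Dec (Hit ts (ts i))) → valBy e (ts i) h ≡ e i
      valBy-hit (yes (j , tⱼ≡tᵢ)) = cong e (ts-injective j i tⱼ≡tᵢ)
      valBy-hit (no miss)         = ⊥-elim (miss (i , refl))

  val-miss : ∀ e {f} us → (∀ i → ts i ≢ app f us) → val e (app f us) ≡ ψ f (vals e us)
  val-miss e {f} us miss = valBy-miss em
    where
      valBy-miss : (h : Dec (Hit ts (app f us))) → valBy e (app f us) h ≡ ψ f (vals e us)
      valBy-miss (yes (i , tᵢ≡u)) = ⊥-elim (miss i tᵢ≡u)
      valBy-miss (no _)           = refl

  mutual
    valBy-local : ∀ e e′ u (h : Dec (Hit ts u)) → (∀ j → ts j ⊑ u → e j ≡ e′ j) → valBy e u h ≡ valBy e′ u h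
    valBy-local e e′ u          (yes (i , refl)) agree = agree i ⊑-refl
    valBy-local e e′ (var _)    (no _)           agree = refl
    valBy-local e e′ (app f us) (no _)           agree =
      cong (ψ f) (vals-local e e′ us (λ j → agree j ∘ ⊑-arg))

    vals-local : ∀ e e′ {k} (us : Vec Term k) → (∀ j → Any (ts j ⊑_) us → e j ≡ e′ j) →
                 vals e us ≡ vals e′ us
    vals-local e e′ []       agree = refl
    vals-local e e′ (u ∷ us) agree =
      cong₂ _∷_ (valBy-local e e′ u em (λ j → agree j ∘ here)) (vals-local e e′ us (λ j → agree j ∘ there))

  evalTop : (Fin n → D) → Term → D
  evalTop e (var _)    = d₀
  evalTop e (app f us) = ψ f (vals e us)

  evalTop-local : ∀ e e′ t → (∀ j → ts j ⊏ t → e j ≡ e′ j) → evalTop e t ≡ evalTop e′ t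
  evalTop-local e e′ (var _)    agree = refl
  evalTop-local e e′ (app f us) agree = cong (ψ f) (vals-local e e′ us (λ j → agree j ∘ ⊏-arg))

  -- e i ≡ strategy e i says that e i is the true value of tᵢ given the frozen values below it.
  strategy : Strategy D n
  strategy e i = evalTop e (ts i)

  strategy-causal : (∀ i j → ts i ⊏ ts j → i < j) → Causal strategy
  strategy-causal ordered e e′ i agree = evalTop-local e e′ (ts i) (λ j tⱼ⊏tᵢ → agree j (ordered j i tⱼ⊏tᵢ))

  Faithful : (Fin n → D) → FunSym → Set
  Faithful e f = ∀ i {ws} → ts i ≡ app f ws → e i ≡ ψ f (vals e ws)

  Faithful-strategy : ∀ {e f} → (∀ i {ws} → ts i ≡ app f ws → e i ≡ strategy e i) → Faithful e f
  Faithful-strategy {e} fixed i tᵢ≡u = trans (fixed i tᵢ≡u) (cong (evalTop e) tᵢ≡u)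

  val-app : ∀ e {f} ws → Faithful e f → val e (app f ws) ≡ ψ f (vals e ws)
  val-app e {f} ws faithful = valBy-app em
    where
      valBy-app : (h : Dec (Hit ts (app f ws))) → valBy e (app f ws) h ≡ ψ f (vals e ws)
      valBy-app (yes (i , tᵢ≡u)) = faithful i tᵢ≡u
      valBy-app (no _)           = refl

  herbrand : (Fin n → D) → Interp Term
  herbrand e = record { funI = app ; predI = λ p us → predI I p (vals e us) }

  mutual
    evalT-herbrand : ∀ e t → evalT (herbrand e) var t ≡ t
    evalT-herbrand e (var x)    = refl
    evalT-herbrand e (app f us) = cong (app f) (evalTs-herbrand e us)

    evalTs-herbrand : ∀ e {k} (us : Vec Term k) → evalTs (herbrand e) var us ≡ us
    evalTs-herbrand e []       = refl
    evalTs-herbrand e (u ∷ us) = cong₂ _∷_ (evalT-herbrand e u) (evalTs-herbrand e us)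

  module _ (e : Fin n → D) (θ : Subst) (μ : Valuation D) where

    mutual
      val-substT : ∀ t → (∀ x → VarInT x t → μ x ≡ val e (θ x)) → (∀ f → FunInT f t → Faithful e f) →
                   val e (substT θ t) ≡ evalT (withFun I ψ) μ t
      val-substT (var x)    μ≡ faithful = sym (μ≡ x here)
      val-substT (app f us) μ≡ faithful =
        trans (val-app e (substTs θ us) (faithful f here))
              (cong (ψ f) (vals-substTs us (λ x → μ≡ x ∘ there) (λ g → faithful g ∘ there)))

      vals-substTs : ∀ {k} (us : Vec Term k) → (∀ x → Any (VarInT x) us → μ x ≡ val e (θ x)) →
                     (∀ f → Any (FunInT f) us → Faithful e f) →
                     vals e (substTs θ us) ≡ evalTs (withFun I ψ) μ us
      vals-substTs []       μ≡ faithful = refl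
      vals-substTs (u ∷ us) μ≡ faithful =
        cong₂ _∷_ (val-substT u (λ x → μ≡ x ∘ here) (λ g → faithful g ∘ here))
                  (vals-substTs us (λ x → μ≡ x ∘ there) (λ g → faithful g ∘ there))

    Sat-substF : ∀ A → QuantifierFree A → (∀ x → VarInF x A → μ x ≡ val e (θ x)) →
                 (∀ f → FunInF f A → Faithful e f) →
                 Sat (herbrand e) var (substF θ A) ≡ Sat (withFun I ψ) μ A
    Sat-substF (atom p us) qf μ≡ faithful =
      cong (predI I p) (trans (cong (vals e) (evalTs-herbrand e (substTs θ us)))
                              (vals-substTs us μ≡ faithful))
    Sat-substF ⊤ᶠ qf μ≡ faithful = refl
    Sat-substF ⊥ᶠ qf μ≡ faithful = refl
    Sat-substF (¬ᶠ A) qf μ≡ faithful = cong ¬_ (Sat-substF A qf μ≡ faithful)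
    Sat-substF (A ∧ᶠ B) (qfA , qfB) μ≡ faithful =
      cong₂ _×_ (Sat-substF A qfA (λ x → μ≡ x ∘ inj₁) (λ f → faithful f ∘ inj₁))
                (Sat-substF B qfB (λ x → μ≡ x ∘ inj₂) (λ f → faithful f ∘ inj₂))
    Sat-substF (A ∨ᶠ B) (qfA , qfB) μ≡ faithful =
      cong₂ _⊎_ (Sat-substF A qfA (λ x → μ≡ x ∘ inj₁) (λ f → faithful f ∘ inj₁))
                (Sat-substF B qfB (λ x → μ≡ x ∘ inj₂) (λ f → faithful f ∘ inj₂))

  module _ (vs : Fin n → Var) (S : FunSym → Set) (ψ≈I : AgreeOutside S ψ (funI I))
           (e : Fin n → D) (ρ : Valuation D) (ρ-vs : ∀ i → ρ (vs i) ≡ e i) where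
    open InverseSubstitution ts vs

    mutual
      evalT-InvT : ∀ {u u′} → InvT n ts vs u u′ → GroundT u → CoveredT ts S u → evalT I ρ u′ ≡ val e u
      evalT-InvT (inv-hit i)   ground cov = trans (ρ-vs i) (sym (val-hit e i))
      evalT-InvT (inv-var x _) ground cov = ⊥-elim (ground x here)
      evalT-InvT (inv-app f {us} {us′} miss r) ground cov = begin
          funI I f (evalTs I ρ us′) ≡⟨ cong (funI I f) (evalTs-InvTs r (λ x → ground x ∘ there) cov-us) ⟩
          funI I f (vals e us)      ≡⟨ sym (ψ≈I f ¬Sf (vals e us)) ⟩
          ψ f (vals e us)           ≡⟨ sym (val-miss e us miss) ⟩
          val e (app f us)          ∎
        where
          open ≡-Reasoning
          ¬Sf = proj₁ (CoveredT-app ts S cov miss)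
          cov-us = proj₂ (CoveredT-app ts S cov miss)

      evalTs-InvTs : ∀ {k} {us us′ : Vec Term k} → InvTs us us′ → (∀ x → ¬ Any (VarInT x) us) →
                     CoveredTs ts S us → evalTs I ρ us′ ≡ vals e us
      evalTs-InvTs []       ground cov = refl
      evalTs-InvTs (r ∷ rs) ground cov =
        cong₂ _∷_ (evalT-InvT r (λ x → ground x ∘ here) (λ t St → cov t St ∘ here))
                  (evalTs-InvTs rs (λ x → ground x ∘ there) (λ t St → cov t St ∘ there))

    Sat-Inv : ∀ {A A′} → Inv A A′ → (∀ x → ¬ VarInF x A) → Covered ts S A →
              Sat (herbrand e) var A ≡ Sat I ρ A′
    Sat-Inv (atom p {us} r) ground cov =
      cong (predI I p) (trans (cong (vals e) (evalTs-herbrand e us)) (sym (evalTs-InvTs r ground cov)))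
    Sat-Inv ⊤ᶠ ground cov = refl
    Sat-Inv ⊥ᶠ ground cov = refl
    Sat-Inv (¬ᶠ r) ground cov = cong ¬_ (Sat-Inv r ground cov)
    Sat-Inv (r ∧ᶠ s) ground cov =
      cong₂ _×_ (Sat-Inv r (λ x → ground x ∘ inj₁) (λ t St → cov t St ∘ inj₁))
                (Sat-Inv s (λ x → ground x ∘ inj₂) (λ t St → cov t St ∘ inj₂))
    Sat-Inv (r ∨ᶠ s) ground cov =
      cong₂ _⊎_ (Sat-Inv r (λ x → ground x ∘ inj₁) (λ t St → cov t St ∘ inj₁))
                (Sat-Inv s (λ x → ground x ∘ inj₂) (λ t St → cov t St ∘ inj₂))
    Sat-Inv (∀ᶠ x r) ground cov = ⊥-elim (ground x (inj₁ refl))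
    Sat-Inv (∃ᶠ x r) ground cov = ⊥-elim (ground x (inj₁ refl))

module Lifting (em : ExcludedMiddle 0ℓ) (B : LiftingBase) where
  open LiftingBase B

  FG : FunSym → Set
  FG f = 𝔽 f ⊎ 𝔾 f

  Fexp-FG⇒𝔽 : ∀ {f} → FunInF f Fexp → FG f → 𝔽 f
  Fexp-FG⇒𝔽 {f} o fg with cond3 f o | fg
  ... | inj₂ 𝔽f          | _       = 𝔽f
  ... | inj₁ _           | inj₁ 𝔽f = 𝔽f
  ... | inj₁ (inF , _)   | inj₂ 𝔾f = ⊥-elim (cond4 f inF 𝔾f)

  Gexp-FG⇒𝔾 : ∀ {f} → FunInF f Gexp → FG f → 𝔾 f
  Gexp-FG⇒𝔾 {f} o fg with cond3' f o | fg
  ... | inj₂ 𝔾f          | _       = 𝔾f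
  ... | inj₁ _           | inj₂ 𝔾f = 𝔾f
  ... | inj₁ (_ , inG)   | inj₁ 𝔽f = ⊥-elim (cond4' f inG 𝔽f)

  exp-shared : ∀ {f} → ¬ FG f → FunInF f Fexp ⊎ FunInF f Gexp → FunInF f F × FunInF f G
  exp-shared ¬FG (inj₁ o) = [ id , ⊥-elim ∘ ¬FG ∘ inj₁ ]′ (cond3 _ o)
  exp-shared ¬FG (inj₂ o) = [ id , ⊥-elim ∘ ¬FG ∘ inj₂ ]′ (cond3' _ o)

  FunInF-Fexpθ : ∀ {f} → ¬ FG f → FunInF f (substF θ Fexp) → FunInF f Fexp ⊎ FunInF f Gexp
  FunInF-Fexpθ ¬FG o with FunInF-substF θ Fexp Fexp-qf o
  ... | inj₁ inFexp = inj₁ inFexp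
  ... | inj₂ (y , y∈ , inθy) with cond6 y _ (cond5← y (inj₁ y∈)) inθy
  ...   | inj₁ inFexp        = inj₁ inFexp
  ...   | inj₂ (inj₁ inGexp) = inj₂ inGexp
  ...   | inj₂ (inj₂ refl)   = ⊥-elim (¬FG c₀-in)

  module Interpolant {n : ℕ} (ts : Fin n → Term) (vs : Fin n → Var) (qs : Fin n → Quant)
                     (ts-injective : ∀ i j → ts i ≡ ts j → i ≡ j)
                     (ts-FG : ∀ i → IsSTerm FG (ts i))
                     (ts-complete : Covered ts FG Hgrd)
                     (ts-ordered : ∀ i j → ts i ⊏ ts j → i < j)
                     (vs-injective : ∀ i j → vs i ≡ vs j → i ≡ j)
                     (qs-spec : ∀ i → (IsSTerm 𝔽 (ts i) → qs i ≡ ∃ᵠ) × (¬ IsSTerm 𝔽 (ts i) → qs i ≡ ∀ᵠ))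
                     (H′ : Formula) (inv : InvF n ts vs Hgrd H′) where
    open InverseSubstitution ts vs

    Hgrd⇝H′ : Inv Hgrd H′
    Hgrd⇝H′ = InvF⇒Inv Hgrd H′ inv

    Hgrd-varfree : ∀ x → ¬ VarInF x Hgrd
    Hgrd-varfree = proj₂ Hgrd-ground

    prefix-pred⊆ : ∀ pol p → PredOcc pol p (prefix n qs vs H′) → PredOcc pol p F × PredOcc pol p G
    prefix-pred⊆ pol p o
      with CraigLyndon.pred⊆ cond7 pol p (Inv-PredOccAt Hgrd⇝H′ (PredOccAt-prefix n qs vs o))
    ... | inFexpθ , inGexpθ = cond2 pol p (PredOccAt-substF θ Fexp Fexp-qf inFexpθ) ,
                              cond2' pol p (PredOccAt-substF θ Gexp Gexp-qf inGexpθ)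

    prefix-fun⊆ : ∀ f → FunInF f (prefix n qs vs H′) → FunInF f F × FunInF f G
    prefix-fun⊆ f o with Inv-FunInF FG Hgrd⇝H′ ts-complete (FunInF-prefix n qs vs o)
    ... | inHgrd , ¬FG = exp-shared ¬FG (FunInF-Fexpθ ¬FG (proj₁ (CraigLyndon.fun⊆ cond7 f inHgrd)))

    prefix-sentence : Sentence (prefix n qs vs H′)
    prefix-sentence x o with FreeIn-prefix n qs vs o
    ... | inH′ , x∉vs with Inv-FreeIn Hgrd⇝H′ Hgrd-varfree inH′
    ...   | i , refl = x∉vs i refl

    ∃-position : ∀ i {f ws} → ts i ≡ app f ws → 𝔽 f → qs i ≡ ∃ᵠ
    ∃-position i tᵢ≡u 𝔽f = proj₁ (qs-spec i) (subst (IsSTerm 𝔽) (sym tᵢ≡u) 𝔽f)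

    ∀-position : ∀ i {f ws} → ts i ≡ app f ws → 𝔾 f → qs i ≡ ∀ᵠ
    ∀-position i tᵢ≡u 𝔾f = proj₂ (qs-spec i) λ 𝔽tᵢ → disjoint _ (subst (IsSTerm 𝔽) tᵢ≡u 𝔽tᵢ) 𝔾f

    head-FG : ∀ i {f ws} → ts i ≡ app f ws → FG f
    head-FG i tᵢ≡u = subst (IsSTerm FG) tᵢ≡u (ts-FG i)

    module Semantics {D : Set} (d : D) (I : Interp D) (ψ : FunInterp D) (ψ≈I : AgreeOutside FG ψ (funI I))
                     (ν : Valuation D) where
      open FrozenEvaluation em ts ts-injective I d ψ

      Hgrd≡H′ : ∀ e → Sat (herbrand e) var Hgrd ≡ Sat I (updVs n vs e ν) H′
      Hgrd≡H′ e = Sat-Inv vs FG ψ≈I e _ (updVs-≡ n vs e ν vs-injective) Hgrd⇝H′ Hgrd-varfree ts-complete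

      frozen : (Fin n → D) → Formula → Valuation D
      frozen e A = patch em A (val e ∘ θ) ν

      frozen-outside : ∀ e A → AgreeOutsideVars A (frozen e A) ν
      frozen-outside e A = patch-outside em A

      expθ≡exp : ∀ e A → QuantifierFree A → (∀ f → FunInF f A → Faithful e f) →
                 Sat (herbrand e) var (substF θ A) ≡ Sat (withFun I ψ) (frozen e A) A
      expθ≡exp e A qf = Sat-substF e θ (frozen e A) A qf (λ x → patch-in em A {val e ∘ θ} {ν})

      prefix-from-Fexp : (∀ μ → AgreeOutsideVars Fexp μ ν → Sat (withFun I ψ) μ Fexp) →
                         Sat I ν (prefix n qs vs H′)
      prefix-from-Fexp Fexp-holds =
        Sat-prefix-intro I d n qs vs ν (strategy-causal ts-ordered) λ e follows →
          subst id (Hgrd≡H′ e)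
            (CraigLyndon.A⊨H cond7 Term (var 0) (herbrand e) var
              (subst id (sym (expθ≡exp e Fexp Fexp-qf (faithful e follows)))
                (Fexp-holds (frozen e Fexp) (frozen-outside e Fexp))))
        where
          faithful : ∀ e → Follows qs ∃ᵠ strategy e → ∀ f → FunInF f Fexp → Faithful e f
          faithful e follows f o =
            Faithful-strategy λ i tᵢ≡u → follows i (∃-position i tᵢ≡u (Fexp-FG⇒𝔽 o (head-FG i tᵢ≡u)))

      prefix-to-Gexp : Sat I ν (prefix n qs vs H′) →
                       ∃ λ μ → AgreeOutsideVars Gexp μ ν × Sat (withFun I ψ) μ Gexp
      prefix-to-Gexp H′-holds with Sat-prefix-elim I d n qs vs ν (strategy-causal ts-ordered) H′-holds
      ... | e , follows , H′-holdsₑ =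
        frozen e Gexp , frozen-outside e Gexp ,
        subst id (expθ≡exp e Gexp Gexp-qf faithful)
          (CraigLyndon.H⊨B cond7 Term (var 0) (herbrand e) var (subst id (sym (Hgrd≡H′ e)) H′-holdsₑ))
        where
          faithful : ∀ f → FunInF f Gexp → Faithful e f
          faithful f o =
            Faithful-strategy λ i tᵢ≡u → follows i (∀-position i tᵢ≡u (Gexp-FG⇒𝔾 o (head-FG i tᵢ≡u)))

    F⊨prefix : F ⊨ prefix n qs vs H′
    F⊨prefix D d I ν F-holds with cond1 D d I ν F-holds
    ... | φ , φ≈I , Fexp-holds =
      Semantics.prefix-from-Fexp d I φ (λ f ¬FG → φ≈I f (¬FG ∘ inj₁)) ν Fexp-holds

    prefix⊨G : prefix n qs vs H′ ⊨ G
    prefix⊨G D d I ν H′-holds = cond1' D d I ν λ φ φ≈I →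
      Semantics.prefix-to-Gexp d I φ (λ f ¬FG → φ≈I f (¬FG ∘ inj₂)) ν H′-holds

theorem2 : ExcludedMiddle 0ℓ →
    (B : LiftingBase) →
    let open LiftingBase B
        FG : FunSym → Set
        FG f = 𝔽 f ⊎ 𝔾 f
    in (n : ℕ) (ts : Fin n → Term) (vs : Fin n → Var) (qs : Fin n → Quant) →
    -- {t₁ … tₙ} (pairwise distinct) is the set of FG-terms with an
    -- FG-terms-maximal occurrence in Hgrd
    (∀ i j → ts i ≡ ts j → i ≡ j) →
    (∀ i → IsSTerm FG (ts i) × MaxOccF (IsSTerm FG) (ts i) Hgrd) →
    (∀ t → IsSTerm FG t → MaxOccF (IsSTerm FG) t Hgrd → Σ (Fin n) λ i → ts i ≡ t) →
    -- ordering: tᵢ strict subterm of tⱼ implies i < j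
    (∀ i j → ts i ⊏ ts j → i < j) →
    -- v₁ … vₙ fresh, pairwise distinct
    (∀ i j → vs i ≡ vs j → i ≡ j) →
    (∀ i → ¬ VarInF (vs i) Hgrd) →
    -- Qᵢ = ∃ if tᵢ is an 𝔽-term, ∀ otherwise
    (∀ i → (IsSTerm 𝔽 (ts i) → qs i ≡ ∃ᵠ) × (¬ IsSTerm 𝔽 (ts i) → qs i ≡ ∀ᵠ)) →
    -- H' = Hgrd σ⁻¹ with σ = { vᵢ ↦ tᵢ }
    (H' : Formula) → InvF n ts vs Hgrd H' →
    CraigLyndon F G (prefix n qs vs H')
-- The vᵢ are automatically fresh, since Hgrd is ground.
theorem2 em B n ts vs qs ts-injective ts-maximal ts-complete ts-ordered vs-injective _ qs-spec H′ inv =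
  record
    { A⊨H   = F⊨prefix
    ; H⊨B   = prefix⊨G
    ; pred⊆ = prefix-pred⊆
    ; fun⊆  = prefix-fun⊆
    ; free⊆ = λ x o → ⊥-elim (prefix-sentence x o)
    }
  where
    open Lifting.Interpolant em B ts vs qs ts-injective (proj₁ ∘ ts-maximal) ts-complete ts-ordered
                             vs-injective qs-spec H′ inv
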